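{- Let $d\geq 2$, $i\geq 1$, and $1\leq r\leq d$. Then \[ b^{[i,i+d-2]}_{[0,d-1]\setminus\{r-1\}}=b_{i+d-r-1,\,d-r}. \]
   Context: For integers $p,q\geq 0$, $b_{p,q}=\binom{p}{q}$, with $b_{p,q}=0$ if $q>p$. For $k\leq l$, $[k,l]=\{k,\ldots,l\}$. For finite sets $I=\{i_1<\cdots<i_m\}$, $J=\{j_1<\cdots<j_m\}$ of non-negative integers, $b^I_J$ is the determinant of the $m\times m$ matrix with $(r,s)$ entry $b_{i_r,j_s}$. -}

module Defs where

open import Data.Nat using (ℕ; zero; suc; _+_; _∸_)
open import Data.Nat.Combinatorics using (_C_)
open import Data.Integer using (ℤ; +_; -_; 0ℤ) renaming (_+_ to _+ℤ_; _*_ to _*ℤ_)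
open import Data.List using (List; []; _∷_; map; length)
open import Data.Bool using (if_then_else_)
open import Data.Nat using (_≡ᵇ_)

-- b_{p,q} = binomial(p,q), which is 0 for q > p (stdlib's  _C_  has this convention)
b : ℕ → ℕ → ℕ
b p q = p C q

-- the integer interval [k,l] = {k,...,l} as an increasing list (empty if l < k)
range : ℕ → ℕ → List ℕ
range k l = go k (suc l ∸ k)
  where
  go : ℕ → ℕ → List ℕ
  go s zero = []
  go s (suc n) = s ∷ go (suc s) n

remove : ℕ → List ℕ → List ℕ
remove x [] = []
remove x (y ∷ ys) = if x ≡ᵇ y then ys' else (y ∷ ys')
  where ys' = remove x ys

deleteAt : {A : Set} → ℕ → List A → List A
deleteAt _ [] = []
deleteAt zero (x ∷ xs) = xs
deleteAt (suc k) (x ∷ xs) = x ∷ deleteAt k xs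

-- determinant of an n×n matrix given as a list of rows, by Laplace expansion
-- along the first row (n = number of rows, used for structural recursion); det of 0×0 is 1.
detN : ℕ → List (List ℤ) → ℤ
detN zero _ = + 1
detN (suc n) [] = + 1
detN (suc n) (row ∷ rows) = go 0 (+ 1) row
  where
  go : ℕ → ℤ → List ℤ → ℤ
  go k sgn [] = 0ℤ
  go k sgn (a ∷ as) =
    (sgn *ℤ (a *ℤ detN n (map (deleteAt k) rows))) +ℤ go (suc k) (- sgn) as

det : List (List ℤ) → ℤ
det M = detN (length M) M

-- b^I_J for increasing lists I = i_1<...<i_m, J = j_1<...<j_m : det (b_{i_r, j_s})_{r,s}
bMinor : List ℕ → List ℕ → ℤ
bMinor I J = det (map (λ i → map (λ j → + b i j) J) I)

-- Write D(i, c, k) for the minor with rows i, …, i+c+k−1 and columns 0, …, c+k except c.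
-- Shifting the rows by one turns each column C(y, j) into C(y+1, j) = C(y, j−1) + C(y, j),
-- and subtracting the left neighbour undoes this along any run of consecutive columns that
-- starts at 0 or right after an unshifted column.  In D(i+1, c, k+1) this leaves only column
-- c+1 shifted; splitting it as C(y, c) + C(y, c+1) gives Pascal's recursion
-- D(i+1, c, k+1) = D(i+1, c+1, k) + D(i, c, k+1).  Together with D(0, m, 0) = 1 (a unitriangular
-- matrix) and D(0, c, k+1) = 0 (its last column vanishes on all rows) this is the recursion
-- of C(i+k−1, k).
module Submission where

open import Defs
open import Function using (_∘_)
open import Data.Nat using (ℕ; zero; suc; _≤_; _<_; _+_; _∸_; _≡ᵇ_; z≤n; s≤s)
open import Data.Bool using (true; false)
import Data.Nat.Properties as ℕP
open import Data.Nat.Combinatorics using (_C_; nCn≡1; k>n⇒nCk≡0; nCk+nC[k+1]≡[n+1]C[k+1])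
open import Data.Integer using (ℤ; +_; -_; 0ℤ)
  renaming (_+_ to _+ℤ_; _*_ to _*ℤ_; _-_ to _-ℤ_)
import Data.Integer.Properties as ℤP
open import Data.Integer.Tactic.RingSolver using (solve-∀)
open import Algebra.Properties.AbelianGroup ℤP.+-0-abelianGroup using (identityʳ-unique)
open import Data.List using (List; []; _∷_; _++_; [_]; map; length)
open import Data.List.Properties
  using (++-assoc; ++-identityʳ; map-++; map-∘; map-cong; length-++; length-++-sucʳ; length-map)
open import Data.List.Relation.Unary.All using (All; []; _∷_; universal)
import Data.List.Relation.Unary.All as All
open import Data.List.Relation.Binary.Pointwise using (Pointwise; []; _∷_; ++⁺)
import Data.List.Relation.Binary.Pointwise as Pointwise
open import Relation.Binary.PropositionalEquality
  using (_≡_; refl; sym; trans; cong; cong₂; module ≡-Reasoning)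
open ≡-Reasoning

private
  variable
    R S : Set

-- Determinants of lists of columns

Column : Set → Set
Column R = R → ℤ

_⊕_ : Column R → Column R → Column R
(f ⊕ g) x = f x +ℤ g x

AgreeOn : List R → Column R → Column R → Set
AgreeOn xs f g = All (λ x → f x ≡ g x) xs

agreeOn-refl : (xs : List R) {f : Column R} → AgreeOn xs f f
agreeOn-refl xs = universal (λ _ → refl) xs

-- Cofactor expansion along the row x: pre holds the columns already passed, so that
-- D (pre ++ post) is the minor of the current column f.
laplace : (List (Column R) → ℤ) → R → List (Column R) → List (Column R) → ℤ
laplace D x pre []         = 0ℤ
laplace D x pre (f ∷ post) = f x *ℤ D (pre ++ post) -ℤ laplace D x (pre ++ [ f ]) post

-- Rows are indexed by xs and the entry in column f is f x.  Every non-square matrix gets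
-- determinant 0, which keeps Δ multilinear without size hypotheses.
Δ : List R → List (Column R) → ℤ
Δ []       []      = + 1
Δ []       (_ ∷ _) = 0ℤ
Δ (x ∷ xs) fs      = laplace (Δ xs) x [] fs

record Linear (F : Column R → ℤ) : Set where
  constructor linear
  field
    additive : (f g : Column R) → F (f ⊕ g) ≡ F f +ℤ F g

open Linear

module _ {F G : Column R → ℤ} where

  linear-cong : (∀ h → F h ≡ G h) → Linear F → Linear G
  linear-cong F≗G linF = linear λ f g → begin
    G (f ⊕ g)  ≡⟨ sym (F≗G (f ⊕ g)) ⟩
    F (f ⊕ g)  ≡⟨ additive linF f g ⟩
    F f +ℤ F g ≡⟨ cong₂ _+ℤ_ (F≗G f) (F≗G g) ⟩
    G f +ℤ G g ∎

  linear-sub : Linear F → Linear G → Linear (λ h → F h -ℤ G h)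
  linear-sub linF linG = linear λ f g →
    trans (cong₂ _-ℤ_ (additive linF f g) (additive linG f g)) (regroup (F f) (F g) (G f) (G g))
    where
    regroup : ∀ a b c d → (a +ℤ b) -ℤ (c +ℤ d) ≡ (a -ℤ c) +ℤ (b -ℤ d)
    regroup = solve-∀

linear-scale : {F : Column R → ℤ} (c : ℤ) → Linear F → Linear (λ h → c *ℤ F h)
linear-scale c linF = linear λ f g → trans (cong (c *ℤ_) (additive linF f g)) (ℤP.*-distribˡ-+ c _ _)

linear-eval : (x : R) (c : ℤ) → Linear (λ h → h x *ℤ c)
linear-eval x c = linear λ f g → ℤP.*-distribʳ-+ c (f x) (g x)

module _ {D : List (Column R) → ℤ} {x : R} where

  laplace-linear-pre : (P : Column R → List (Column R)) →
                       (∀ L → Linear (λ h → D (P h ++ L))) →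
                       ∀ post → Linear (λ h → laplace D x (P h) post)
  laplace-linear-pre P lin []         = linear λ _ _ → refl
  laplace-linear-pre P lin (p ∷ post) =
    linear-sub (linear-scale (p x) (lin post))
      (laplace-linear-pre (λ h → P h ++ [ p ])
        (λ L → linear-cong (λ h → cong D (sym (++-assoc (P h) [ p ] L))) (lin (p ∷ L)))
        post)

  laplace-linear : (∀ A B → Linear (λ h → D (A ++ h ∷ B))) →
                   ∀ pre A B → Linear (λ h → laplace D x pre (A ++ h ∷ B))
  laplace-linear lin pre [] B =
    linear-sub (linear-eval x (D (pre ++ B)))
      (laplace-linear-pre (λ h → pre ++ [ h ])
        (λ L → linear-cong (λ h → cong D (sym (++-assoc pre [ h ] L))) (lin pre L))
        B)
  laplace-linear lin pre (a ∷ A) B =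
    linear-sub
      (linear-scale (a x)
        (linear-cong (λ h → cong D (++-assoc pre A (h ∷ B))) (lin (pre ++ A) B)))
      (laplace-linear lin (pre ++ [ a ]) A B)

  laplace-cong : ∀ {xs pre pre′ post post′} →
                 (∀ {L L′} → Pointwise (AgreeOn xs) L L′ → D L ≡ D L′) →
                 Pointwise (AgreeOn (x ∷ xs)) pre pre′ →
                 Pointwise (AgreeOn (x ∷ xs)) post post′ →
                 laplace D x pre post ≡ laplace D x pre′ post′
  laplace-cong D-cong pre≈ []                     = refl
  laplace-cong D-cong pre≈ (f≈@(fx≡ ∷ _) ∷ post≈) =
    cong₂ _-ℤ_
      (cong₂ _*ℤ_ fx≡ (D-cong (++⁺ (Pointwise.map All.tail pre≈) (Pointwise.map All.tail post≈))))
      (laplace-cong D-cong (++⁺ pre≈ (f≈ ∷ [])) post≈)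

  laplace-zero-minors : ∀ P → (∀ L → D (P ++ L) ≡ 0ℤ) → ∀ post → laplace D x P post ≡ 0ℤ
  laplace-zero-minors P minors≡0 []         = refl
  laplace-zero-minors P minors≡0 (p ∷ post) = begin
    p x *ℤ D (P ++ post) -ℤ laplace D x (P ++ [ p ]) post
      ≡⟨ cong₂ (λ u v → p x *ℤ u -ℤ v) (minors≡0 post)
           (laplace-zero-minors (P ++ [ p ])
              (λ L → trans (cong D (++-assoc P [ p ] L)) (minors≡0 (p ∷ L))) post) ⟩
    p x *ℤ 0ℤ -ℤ 0ℤ
      ≡⟨ cong (_-ℤ 0ℤ) (ℤP.*-zeroʳ (p x)) ⟩
    0ℤ ∎

  laplace-zero-row : ∀ pre post → All (λ g → g x ≡ 0ℤ) post → laplace D x pre post ≡ 0ℤ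
  laplace-zero-row pre []         []              = refl
  laplace-zero-row pre (p ∷ post) (px≡0 ∷ post≡0) =
    cong₂ (λ u v → u *ℤ D (pre ++ post) -ℤ v) px≡0 (laplace-zero-row (pre ++ [ p ]) post post≡0)

  laplace-adjacent : ∀ {f g} → f x ≡ g x →
                     (∀ A B → D (A ++ f ∷ B) ≡ D (A ++ g ∷ B)) →
                     (∀ A B → D (A ++ f ∷ g ∷ B) ≡ 0ℤ) →
                     ∀ pre A B → laplace D x pre (A ++ f ∷ g ∷ B) ≡ 0ℤ
  laplace-adjacent {f} {g} fx≡gx swap adjacent pre [] B = begin
    f x *ℤ D (pre ++ g ∷ B)
      -ℤ (g x *ℤ D ((pre ++ [ f ]) ++ B) -ℤ laplace D x ((pre ++ [ f ]) ++ [ g ]) B)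
      ≡⟨ cong₂ (λ u v → f x *ℤ D (pre ++ g ∷ B) -ℤ (u -ℤ v))
           (cong₂ _*ℤ_ (sym fx≡gx) (trans (cong D (++-assoc pre [ f ] B)) (swap pre B)))
           (laplace-zero-minors ((pre ++ [ f ]) ++ [ g ])
              (λ L → trans (cong D (shuffle L)) (adjacent pre L)) B) ⟩
    f x *ℤ D (pre ++ g ∷ B) -ℤ (f x *ℤ D (pre ++ g ∷ B) -ℤ 0ℤ)
      ≡⟨ cancel (f x *ℤ D (pre ++ g ∷ B)) ⟩
    0ℤ ∎
    where
    shuffle : ∀ L → ((pre ++ [ f ]) ++ [ g ]) ++ L ≡ pre ++ f ∷ g ∷ L
    shuffle L = trans (++-assoc (pre ++ [ f ]) [ g ] L) (++-assoc pre [ f ] (g ∷ L))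
    cancel : ∀ a → a -ℤ (a -ℤ 0ℤ) ≡ 0ℤ
    cancel = solve-∀
  laplace-adjacent fx≡gx swap adjacent pre (a ∷ A) B = begin
    a x *ℤ D (pre ++ A ++ _) -ℤ laplace D x (pre ++ [ a ]) (A ++ _)
      ≡⟨ cong₂ (λ u v → a x *ℤ u -ℤ v)
           (trans (cong D (sym (++-assoc pre A _))) (adjacent (pre ++ A) B))
           (laplace-adjacent fx≡gx swap adjacent (pre ++ [ a ]) A B) ⟩
    a x *ℤ 0ℤ -ℤ 0ℤ
      ≡⟨ cong (_-ℤ 0ℤ) (ℤP.*-zeroʳ (a x)) ⟩
    0ℤ ∎

laplace-map-rows : {D : List (Column R) → ℤ} {D′ : List (Column S) → ℤ} (ρ : S → R) {y : S} →
                   (∀ L → D L ≡ D′ (map (_∘ ρ) L)) →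
                   ∀ pre post →
                   laplace D (ρ y) pre post ≡ laplace D′ y (map (_∘ ρ) pre) (map (_∘ ρ) post)
laplace-map-rows ρ minors pre []         = refl
laplace-map-rows {D′ = D′} ρ {y} minors pre (f ∷ post) =
  cong₂ (λ u v → f (ρ y) *ℤ u -ℤ v)
    (trans (minors (pre ++ post)) (cong D′ (map-++ (_∘ ρ) pre post)))
    (trans (laplace-map-rows ρ minors (pre ++ [ f ]) post)
           (cong (λ P → laplace D′ y P (map (_∘ ρ) post)) (map-++ (_∘ ρ) pre [ f ])))

Δ-linear : (xs : List R) → ∀ A B → Linear (λ h → Δ xs (A ++ h ∷ B))
Δ-linear []       []      B = linear λ _ _ → refl
Δ-linear []       (_ ∷ _) B = linear λ _ _ → refl
Δ-linear (x ∷ xs) A       B = laplace-linear (Δ-linear xs) [] A B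

Δ-cong : {xs : List R} {fs gs : List (Column R)} → Pointwise (AgreeOn xs) fs gs → Δ xs fs ≡ Δ xs gs
Δ-cong {xs = []}     []      = refl
Δ-cong {xs = []}     (_ ∷ _) = refl
Δ-cong {xs = x ∷ xs} fs≈gs   = laplace-cong (Δ-cong {xs = xs}) [] fs≈gs

Δ-cong-column : (xs : List R) → ∀ A B {f g} → AgreeOn xs f g → Δ xs (A ++ f ∷ B) ≡ Δ xs (A ++ g ∷ B)
Δ-cong-column xs A B f≈g =
  Δ-cong (++⁺ (Pointwise.refl (agreeOn-refl xs)) (f≈g ∷ Pointwise.refl (agreeOn-refl xs)))

Δ-adjacent : (xs : List R) → ∀ A B {f g} → AgreeOn xs f g → Δ xs (A ++ f ∷ g ∷ B) ≡ 0ℤ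
Δ-adjacent []       []      B _             = refl
Δ-adjacent []       (_ ∷ _) B _             = refl
Δ-adjacent (x ∷ xs) A       B (fx≡gx ∷ f≈g) =
  laplace-adjacent fx≡gx (λ A′ B′ → Δ-cong-column xs A′ B′ f≈g) (λ A′ B′ → Δ-adjacent xs A′ B′ f≈g)
    [] A B

Δ-zero-column : (xs : List R) → ∀ A B {z} → AgreeOn xs z (λ _ → 0ℤ) → Δ xs (A ++ z ∷ B) ≡ 0ℤ
Δ-zero-column xs A B {z} z≈0 = identityʳ-unique (F z) (F z) (begin
  F z +ℤ F z ≡⟨ additive (Δ-linear xs A B) z z ⟨
  F (z ⊕ z)  ≡⟨ Δ-cong-column xs A B (All.map (λ zx≡0 → trans (cong₂ _+ℤ_ zx≡0 zx≡0) (sym zx≡0)) z≈0) ⟩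
  F z        ∎)
  where
  F : Column _ → ℤ
  F h = Δ xs (A ++ h ∷ B)

Δ-subtract-left : (xs : List R) → ∀ A B {g h f} → AgreeOn xs h (g ⊕ f) →
                  Δ xs (A ++ g ∷ h ∷ B) ≡ Δ xs (A ++ g ∷ f ∷ B)
Δ-subtract-left xs A B {g} {h} {f} h≈g⊕f = begin
  Δ xs (A ++ g ∷ h ∷ B)                    ≡⟨ cong (Δ xs) (sym (++-assoc A [ g ] _)) ⟩
  Δ xs (A′ ++ h ∷ B)                       ≡⟨ Δ-cong-column xs A′ B h≈g⊕f ⟩
  Δ xs (A′ ++ (g ⊕ f) ∷ B)                 ≡⟨ additive (Δ-linear xs A′ B) g f ⟩
  Δ xs (A′ ++ g ∷ B) +ℤ Δ xs (A′ ++ f ∷ B) ≡⟨ cong₂ _+ℤ_ gg≡0 (cong (Δ xs) (++-assoc A [ g ] _)) ⟩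
  0ℤ +ℤ Δ xs (A ++ g ∷ f ∷ B)              ≡⟨ ℤP.+-identityˡ _ ⟩
  Δ xs (A ++ g ∷ f ∷ B)                    ∎
  where
  A′ = A ++ [ g ]
  gg≡0 : Δ xs (A′ ++ g ∷ B) ≡ 0ℤ
  gg≡0 = trans (cong (Δ xs) (++-assoc A [ g ] _)) (Δ-adjacent xs A B (agreeOn-refl xs))

Δ-unit-row : ∀ {x : R} {xs f gs} → f x ≡ + 1 → All (λ g → g x ≡ 0ℤ) gs → Δ (x ∷ xs) (f ∷ gs) ≡ Δ xs gs
Δ-unit-row {x = x} {xs} {f} {gs} fx≡1 row≡0 = begin
  f x *ℤ Δ xs gs -ℤ laplace (Δ xs) x [ f ] gs
    ≡⟨ cong₂ (λ u v → u *ℤ Δ xs gs -ℤ v) fx≡1 (laplace-zero-row [ f ] gs row≡0) ⟩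
  + 1 *ℤ Δ xs gs -ℤ 0ℤ
    ≡⟨ trans (ℤP.+-identityʳ _) (ℤP.*-identityˡ _) ⟩
  Δ xs gs ∎

Δ-map-rows : (ρ : S → R) (xs : List S) (fs : List (Column R)) → Δ (map ρ xs) fs ≡ Δ xs (map (_∘ ρ) fs)
Δ-map-rows ρ []       []      = refl
Δ-map-rows ρ []       (_ ∷ _) = refl
Δ-map-rows ρ (x ∷ xs) fs      = laplace-map-rows ρ (Δ-map-rows ρ xs) [] fs

matrix : List R → List (Column R) → List (List ℤ)
matrix xs fs = map (λ x → map (λ f → f x) fs) xs

-- A copy of the row loop that Defs defines locally inside detN.
cofactorSum : ℕ → List (List ℤ) → ℕ → ℤ → List ℤ → ℤ
cofactorSum n rows k s []       = 0ℤ
cofactorSum n rows k s (a ∷ as) =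
  s *ℤ (a *ℤ detN n (map (deleteAt k) rows)) +ℤ cofactorSum n rows (suc k) (- s) as

cofactorSum-unique : ∀ n rows (F : ℕ → ℤ → List ℤ → ℤ) →
  (∀ k s → F k s [] ≡ 0ℤ) →
  (∀ k s a as → F k s (a ∷ as) ≡ s *ℤ (a *ℤ detN n (map (deleteAt k) rows)) +ℤ F (suc k) (- s) as) →
  ∀ k s as → F k s as ≡ cofactorSum n rows k s as
cofactorSum-unique n rows F F[] F∷ k s []       = F[] k s
cofactorSum-unique n rows F F[] F∷ k s (a ∷ as) =
  trans (F∷ k s a as)
        (cong (s *ℤ (a *ℤ detN n (map (deleteAt k) rows)) +ℤ_)
              (cofactorSum-unique n rows F F[] F∷ (suc k) (- s) as))

-- Abstracting the start values 0 and + 1 lets unification instantiate F in cofactorSum-unique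
-- with the local loop of detN.
detN-suc : ∀ n rows → (row : List ℤ) → detN (suc n) (row ∷ rows) ≡ cofactorSum n rows 0 (+ 1) row
detN-suc n rows with 0 | + 1 | cofactorSum-unique n rows _ (λ _ _ → refl) (λ _ _ _ _ → refl)
... | k | s | unique = unique k s

deleteAt-map : ∀ {A B : Set} (g : A → B) k xs → deleteAt k (map g xs) ≡ map g (deleteAt k xs)
deleteAt-map g k       []       = refl
deleteAt-map g zero    (x ∷ xs) = refl
deleteAt-map g (suc k) (x ∷ xs) = cong (g x ∷_) (deleteAt-map g k xs)

deleteAt-middle : ∀ {A : Set} (pre : List A) f post →
                  deleteAt (length pre) (pre ++ f ∷ post) ≡ pre ++ post
deleteAt-middle []        f post = refl
deleteAt-middle (p ∷ pre) f post = cong (p ∷_) (deleteAt-middle pre f post)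

deleteAt-matrix : ∀ k (xs : List R) fs → map (deleteAt k) (matrix xs fs) ≡ matrix xs (deleteAt k fs)
deleteAt-matrix k xs fs = trans (sym (map-∘ xs)) (map-cong (λ x → deleteAt-map (λ f → f x) k fs) xs)

module _ {x : R} {xs : List R}
         (minors : ∀ gs → length gs ≡ length xs → detN (length xs) (matrix xs gs) ≡ Δ xs gs) where

  cofactorSum-laplace : ∀ {fs} pre post k s →
    pre ++ post ≡ fs → k ≡ length pre → length fs ≡ suc (length xs) →
    cofactorSum (length xs) (matrix xs fs) k s (map (λ f → f x) post) ≡ s *ℤ laplace (Δ xs) x pre post
  cofactorSum-laplace pre []         k s _    _    _   = sym (ℤP.*-zeroʳ s)
  cofactorSum-laplace pre (f ∷ post) _ s refl refl len = begin
    s *ℤ (f x *ℤ detN n (map (deleteAt (length pre)) (matrix xs (pre ++ f ∷ post))))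
      +ℤ cofactorSum n (matrix xs (pre ++ f ∷ post)) (suc (length pre)) (- s) (map (λ g → g x) post)
      ≡⟨ cong₂ (λ u v → s *ℤ (f x *ℤ u) +ℤ v) minor rest ⟩
    s *ℤ (f x *ℤ Δ xs (pre ++ post)) +ℤ (- s) *ℤ laplace (Δ xs) x (pre ++ [ f ]) post
      ≡⟨ factor s (f x) _ _ ⟩
    s *ℤ (f x *ℤ Δ xs (pre ++ post) -ℤ laplace (Δ xs) x (pre ++ [ f ]) post) ∎
    where
    n = length xs
    factor : ∀ s a d e → s *ℤ (a *ℤ d) +ℤ (- s) *ℤ e ≡ s *ℤ (a *ℤ d -ℤ e)
    factor = solve-∀
    minor : detN n (map (deleteAt (length pre)) (matrix xs (pre ++ f ∷ post))) ≡ Δ xs (pre ++ post)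
    minor = begin
      detN n (map (deleteAt (length pre)) (matrix xs (pre ++ f ∷ post)))
        ≡⟨ cong (detN n) (deleteAt-matrix (length pre) xs (pre ++ f ∷ post)) ⟩
      detN n (matrix xs (deleteAt (length pre) (pre ++ f ∷ post)))
        ≡⟨ cong (detN n ∘ matrix xs) (deleteAt-middle pre f post) ⟩
      detN n (matrix xs (pre ++ post))
        ≡⟨ minors (pre ++ post) (ℕP.suc-injective (trans (sym (length-++-sucʳ pre f post)) len)) ⟩
      Δ xs (pre ++ post) ∎
    rest : cofactorSum n (matrix xs (pre ++ f ∷ post)) (suc (length pre)) (- s) (map (λ g → g x) post)
           ≡ (- s) *ℤ laplace (Δ xs) x (pre ++ [ f ]) post
    rest = cofactorSum-laplace (pre ++ [ f ]) post (suc (length pre)) (- s) (++-assoc pre [ f ] post)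
             (trans (ℕP.+-comm 1 (length pre)) (sym (length-++ pre))) len

detN-matrix : (xs : List R) (fs : List (Column R)) → length fs ≡ length xs →
              detN (length xs) (matrix xs fs) ≡ Δ xs fs
detN-matrix []       []      _   = refl
detN-matrix []       (_ ∷ _) ()
detN-matrix (x ∷ xs) fs      len = begin
  detN (suc (length xs)) (map (λ f → f x) fs ∷ matrix xs fs)
    ≡⟨ detN-suc (length xs) (matrix xs fs) (map (λ f → f x) fs) ⟩
  cofactorSum (length xs) (matrix xs fs) 0 (+ 1) (map (λ f → f x) fs)
    ≡⟨ cofactorSum-laplace (detN-matrix xs) [] fs 0 (+ 1) refl refl len ⟩
  + 1 *ℤ Δ (x ∷ xs) fs
    ≡⟨ ℤP.*-identityˡ _ ⟩
  Δ (x ∷ xs) fs ∎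

binom : ℕ → Column ℕ
binom j y = + (y C j)

bMinor-Δ : ∀ I J → length J ≡ length I → bMinor I J ≡ Δ I (map binom J)
bMinor-Δ I J len = begin
  detN (length M) M
    ≡⟨ cong (λ N → detN (length N) N) (map-cong (λ i → map-∘ J) I) ⟩
  detN (length (matrix I (map binom J))) (matrix I (map binom J))
    ≡⟨ cong (λ n → detN n (matrix I (map binom J))) (length-map _ I) ⟩
  detN (length I) (matrix I (map binom J))
    ≡⟨ detN-matrix I (map binom J) (trans (length-map binom J) len) ⟩
  Δ I (map binom J) ∎
  where
  M = map (λ i → map (λ j → + b i j) J) I

interval : ℕ → ℕ → List ℕ
interval s zero    = []
interval s (suc n) = s ∷ interval (suc s) n

punctured : ℕ → ℕ → List ℕ
punctured c k = interval 0 c ++ interval (suc c) k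

length-interval : ∀ s n → length (interval s n) ≡ n
length-interval s zero    = refl
length-interval s (suc n) = cong suc (length-interval (suc s) n)

length-punctured : ∀ c k → length (punctured c k) ≡ c + k
length-punctured c k =
  trans (length-++ (interval 0 c)) (cong₂ _+_ (length-interval 0 c) (length-interval (suc c) k))

interval-suc : ∀ s n → interval (suc s) n ≡ map suc (interval s n)
interval-suc s zero    = refl
interval-suc s (suc n) = cong (suc s ∷_) (interval-suc (suc s) n)

interval-snoc : ∀ s n → interval s (suc n) ≡ interval s n ++ [ s + n ]
interval-snoc s zero    = cong [_] (sym (ℕP.+-identityʳ s))
interval-snoc s (suc n) =
  cong (s ∷_) (trans (interval-snoc (suc s) n)
                     (cong (λ t → interval (suc s) n ++ [ t ]) (sym (ℕP.+-suc s n))))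

range-≤ : ∀ {k l} → k ≤ l → range k l ≡ k ∷ range (suc k) l
range-≤ k≤l rewrite ℕP.+-∸-assoc 1 k≤l = refl

range-> : ∀ {k l} → l < k → range k l ≡ []
range-> l<k rewrite ℕP.m≤n⇒m∸n≡0 l<k = refl

range-interval : ∀ {s l} n → s + n ≡ suc l → range s l ≡ interval s n
range-interval {s} zero    s+0≡1+l   = range-> (ℕP.≤-reflexive (trans (sym s+0≡1+l) (ℕP.+-identityʳ s)))
range-interval {s} (suc n) s+1+n≡1+l =
  trans (range-≤ (ℕP.≤-trans (ℕP.m≤m+n s n) (ℕP.≤-reflexive (ℕP.suc-injective 1+s+n≡1+l))))
        (cong (s ∷_) (range-interval n 1+s+n≡1+l))
  where
  1+s+n≡1+l = trans (sym (ℕP.+-suc s n)) s+1+n≡1+l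

remove-zero : ∀ s n → remove 0 (interval (suc s) n) ≡ interval (suc s) n
remove-zero s zero    = refl
remove-zero s (suc n) = cong (suc s ∷_) (remove-zero (suc s) n)

remove-suc : ∀ x ys → remove (suc x) (map suc ys) ≡ map suc (remove x ys)
remove-suc x []       = refl
remove-suc x (y ∷ ys) with x ≡ᵇ y
... | true  = remove-suc x ys
... | false = cong (suc y ∷_) (remove-suc x ys)

remove-interval : ∀ c k → remove c (interval 0 (suc (c + k))) ≡ punctured c k
remove-interval zero    k = remove-zero 0 k
remove-interval (suc c) k = cong (0 ∷_) (begin
  remove (suc c) (interval 1 (suc (c + k)))
    ≡⟨ cong (remove (suc c)) (interval-suc 0 (suc (c + k))) ⟩
  remove (suc c) (map suc (interval 0 (suc (c + k))))
    ≡⟨ remove-suc c (interval 0 (suc (c + k))) ⟩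
  map suc (remove c (interval 0 (suc (c + k))))
    ≡⟨ cong (map suc) (remove-interval c k) ⟩
  map suc (interval 0 c ++ interval (suc c) k)
    ≡⟨ map-++ suc (interval 0 c) _ ⟩
  map suc (interval 0 c) ++ map suc (interval (suc c) k)
    ≡⟨ sym (cong₂ _++_ (interval-suc 0 c) (interval-suc (suc c) k)) ⟩
  interval 1 c ++ interval (suc (suc c)) k ∎)

-- Minors of the binomial matrix

binom⁺ : ℕ → Column ℕ
binom⁺ j y = + (suc y C j)

binom⁺-suc : ∀ j y → binom⁺ (suc j) y ≡ (binom j ⊕ binom (suc j)) y
binom⁺-suc j y = cong +_ (sym (nCk+nC[k+1]≡[n+1]C[k+1] y j))

binom-vanishes : ∀ j s n → s + n ≤ j → AgreeOn (interval s n) (binom j) (λ _ → 0ℤ)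
binom-vanishes j s zero    _         = []
binom-vanishes j s (suc n) s+1+n≤j =
  cong +_ (k>n⇒nCk≡0 (ℕP.<-≤-trans (ℕP.m<m+n s (s≤s z≤n)) s+1+n≤j)) ∷
  binom-vanishes j (suc s) n (ℕP.≤-trans (ℕP.≤-reflexive (sym (ℕP.+-suc s n))) s+1+n≤j)

binom-row-zero : ∀ s n → All (λ g → g 0 ≡ 0ℤ) (map binom (interval (suc s) n))
binom-row-zero s zero    = []
binom-row-zero s (suc n) = refl ∷ binom-row-zero (suc s) n

module _ (xs : List ℕ) where

  unshift-block : ∀ A B s n →
    Δ xs (A ++ binom s ∷ map binom⁺ (interval (suc s) n) ++ B) ≡
    Δ xs (A ++ binom s ∷ map binom (interval (suc s) n) ++ B)
  unshift-block A B s zero    = refl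
  unshift-block A B s (suc n) = begin
    Δ xs (A ++ binom s ∷ binom⁺ (suc s) ∷ T⁺)
      ≡⟨ Δ-subtract-left xs A T⁺ (universal (binom⁺-suc s) xs) ⟩
    Δ xs (A ++ binom s ∷ binom (suc s) ∷ T⁺)
      ≡⟨ cong (Δ xs) (sym (++-assoc A [ binom s ] _)) ⟩
    Δ xs ((A ++ [ binom s ]) ++ binom (suc s) ∷ T⁺)
      ≡⟨ unshift-block (A ++ [ binom s ]) B (suc s) n ⟩
    Δ xs ((A ++ [ binom s ]) ++ binom (suc s) ∷ T)
      ≡⟨ cong (Δ xs) (++-assoc A [ binom s ] _) ⟩
    Δ xs (A ++ binom s ∷ binom (suc s) ∷ T) ∎
    where
    T⁺ = map binom⁺ (interval (suc (suc s)) n) ++ B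
    T  = map binom  (interval (suc (suc s)) n) ++ B

  unshift-prefix : ∀ n B → Δ xs (map binom⁺ (interval 0 n) ++ B) ≡ Δ xs (map binom (interval 0 n) ++ B)
  unshift-prefix zero    B = refl
  unshift-prefix (suc n) B =
    trans (Δ-cong-column xs [] _ (agreeOn-refl xs)) (unshift-block [] B 0 n)

Δ-shift-rows : ∀ i m c L →
  Δ (interval (suc i) m) (map binom (interval 0 c ++ L)) ≡
  Δ (interval i m) (map binom (interval 0 c) ++ map binom⁺ L)
Δ-shift-rows i m c L = begin
  Δ (interval (suc i) m) (map binom (interval 0 c ++ L))
    ≡⟨ cong (λ xs → Δ xs _) (interval-suc i m) ⟩
  Δ (map suc (interval i m)) (map binom (interval 0 c ++ L))
    ≡⟨ Δ-map-rows suc (interval i m) _ ⟩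
  Δ (interval i m) (map (_∘ suc) (map binom (interval 0 c ++ L)))
    ≡⟨ cong (Δ (interval i m)) (sym (map-∘ (interval 0 c ++ L))) ⟩
  Δ (interval i m) (map binom⁺ (interval 0 c ++ L))
    ≡⟨ cong (Δ (interval i m)) (map-++ binom⁺ (interval 0 c) L) ⟩
  Δ (interval i m) (map binom⁺ (interval 0 c) ++ map binom⁺ L)
    ≡⟨ unshift-prefix (interval i m) c _ ⟩
  Δ (interval i m) (map binom (interval 0 c) ++ map binom⁺ L) ∎

-- D(i, c, k) of the proof idea is binomMinor i (c + k) c k.
binomMinor : ℕ → ℕ → ℕ → ℕ → ℤ
binomMinor i m c k = Δ (interval i m) (map binom (punctured c k))

binomMinor-unit-row : ∀ m → binomMinor 0 (suc m) (suc m) 0 ≡ binomMinor 1 m 0 m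
binomMinor-unit-row m = begin
  Δ (0 ∷ interval 1 m) (binom 0 ∷ map binom (interval 1 m ++ []))
    ≡⟨ cong (λ J → Δ (0 ∷ interval 1 m) (binom 0 ∷ map binom J)) (++-identityʳ (interval 1 m)) ⟩
  Δ (0 ∷ interval 1 m) (binom 0 ∷ map binom (interval 1 m))
    ≡⟨ Δ-unit-row {xs = interval 1 m} {f = binom 0} refl (binom-row-zero 0 m) ⟩
  Δ (interval 1 m) (map binom (interval 1 m)) ∎

binomMinor-last-column : ∀ m c k → c + suc k ≡ m → binomMinor 0 m c (suc k) ≡ 0ℤ
binomMinor-last-column m c k c+1+k≡m = begin
  Δ (interval 0 m) (map binom (interval 0 c ++ interval (suc c) (suc k)))
    ≡⟨ cong (λ J → Δ (interval 0 m) (map binom (interval 0 c ++ J))) (interval-snoc (suc c) k) ⟩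
  Δ (interval 0 m) (map binom (interval 0 c ++ interval (suc c) k ++ [ last ]))
    ≡⟨ cong (Δ (interval 0 m) ∘ map binom) (sym (++-assoc (interval 0 c) _ _)) ⟩
  Δ (interval 0 m) (map binom (punctured c k ++ [ last ]))
    ≡⟨ cong (Δ (interval 0 m)) (map-++ binom (punctured c k) _) ⟩
  Δ (interval 0 m) (map binom (punctured c k) ++ [ binom last ])
    ≡⟨ Δ-zero-column (interval 0 m) _ [] (binom-vanishes last 0 m m≤last) ⟩
  0ℤ ∎
  where
  last = suc c + k
  m≤last = ℕP.≤-reflexive (trans (sym c+1+k≡m) (ℕP.+-suc c k))

binomMinor-shift : ∀ i m c → binomMinor (suc i) m c 0 ≡ binomMinor i m c 0
binomMinor-shift i m c = begin
  Δ (interval (suc i) m) (map binom (interval 0 c ++ []))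
    ≡⟨ Δ-shift-rows i m c [] ⟩
  Δ (interval i m) (map binom (interval 0 c) ++ [])
    ≡⟨ cong (Δ (interval i m)) (sym (map-++ binom (interval 0 c) [])) ⟩
  Δ (interval i m) (map binom (interval 0 c ++ [])) ∎

binomMinor-pascal : ∀ i m c k →
  binomMinor (suc i) m c (suc k) ≡ binomMinor (suc i) m (suc c) k +ℤ binomMinor i m c (suc k)
binomMinor-pascal i m c k = begin
  Δ (interval (suc i) m) (map binom (interval 0 c ++ suc c ∷ interval (suc (suc c)) k))
    ≡⟨ Δ-shift-rows i m c _ ⟩
  Δ rows (P ++ binom⁺ (suc c) ∷ T⁺)
    ≡⟨ Δ-cong-column rows P T⁺ (universal (binom⁺-suc c) rows) ⟩
  Δ rows (P ++ (binom c ⊕ binom (suc c)) ∷ T⁺)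
    ≡⟨ additive (Δ-linear rows P T⁺) (binom c) (binom (suc c)) ⟩
  Δ rows (P ++ binom c ∷ T⁺) +ℤ Δ rows (P ++ binom (suc c) ∷ T⁺)
    ≡⟨ cong₂ _+ℤ_ column-c column-c+1 ⟩
  binomMinor (suc i) m (suc c) k +ℤ binomMinor i m c (suc k) ∎
  where
  rows = interval i m
  P    = map binom (interval 0 c)
  T⁺   = map binom⁺ (interval (suc (suc c)) k)
  column-c : Δ rows (P ++ binom c ∷ T⁺) ≡ binomMinor (suc i) m (suc c) k
  column-c = begin
    Δ rows (P ++ binom c ∷ T⁺)
      ≡⟨ cong (Δ rows) (sym (++-assoc P [ binom c ] T⁺)) ⟩
    Δ rows ((P ++ [ binom c ]) ++ T⁺)
      ≡⟨ cong (λ J → Δ rows (J ++ T⁺)) (sym (map-++ binom (interval 0 c) [ c ])) ⟩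
    Δ rows (map binom (interval 0 c ++ [ c ]) ++ T⁺)
      ≡⟨ cong (λ J → Δ rows (map binom J ++ T⁺)) (sym (interval-snoc 0 c)) ⟩
    Δ rows (map binom (interval 0 (suc c)) ++ T⁺)
      ≡⟨ Δ-shift-rows i m (suc c) _ ⟨
    binomMinor (suc i) m (suc c) k ∎
  column-c+1 : Δ rows (P ++ binom (suc c) ∷ T⁺) ≡ binomMinor i m c (suc k)
  column-c+1 = begin
    Δ rows (P ++ binom (suc c) ∷ T⁺)
      ≡⟨ cong (λ T → Δ rows (P ++ binom (suc c) ∷ T)) (sym (++-identityʳ T⁺)) ⟩
    Δ rows (P ++ binom (suc c) ∷ T⁺ ++ [])
      ≡⟨ unshift-block rows P [] (suc c) k ⟩
    Δ rows (P ++ binom (suc c) ∷ map binom (interval (suc (suc c)) k) ++ [])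
      ≡⟨ cong (λ T → Δ rows (P ++ binom (suc c) ∷ T)) (++-identityʳ _) ⟩
    Δ rows (P ++ map binom (interval (suc c) (suc k)))
      ≡⟨ cong (Δ rows) (sym (map-++ binom (interval 0 c) _)) ⟩
    binomMinor i m c (suc k) ∎

pascal : ∀ i k → + ((i + k) C k) +ℤ + ((i + suc k ∸ 1) C suc k) ≡ + ((i + suc k) C suc k)
pascal i k rewrite ℕP.+-suc i k = cong +_ (nCk+nC[k+1]≡[n+1]C[k+1] (i + k) k)

-- The redundant argument m = c + k makes the recursion structural: the case i = 0, k = 0
-- recurses to i = 1 with a smaller m.
binomMinor≡binomial : ∀ m i c k → c + k ≡ m → binomMinor i m c k ≡ + ((i + k ∸ 1) C k)
binomMinor≡binomial zero    zero    zero    zero    refl   = refl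
binomMinor≡binomial zero    zero    (suc c) zero    ()
binomMinor≡binomial (suc m) zero    c       zero    c+0≡m  with trans (sym (ℕP.+-identityʳ c)) c+0≡m
... | refl =
  trans (binomMinor-unit-row m) (trans (binomMinor≡binomial m 1 0 m refl) (cong +_ (nCn≡1 m)))
binomMinor≡binomial m       zero    c       (suc k) c+k≡m  =
  trans (binomMinor-last-column m c k c+k≡m) (cong +_ (sym (k>n⇒nCk≡0 (ℕP.n<1+n k))))
binomMinor≡binomial m       (suc i) c       zero    c+0≡m  =
  trans (binomMinor-shift i m c) (binomMinor≡binomial m i c zero c+0≡m)
binomMinor≡binomial m       (suc i) c       (suc k) c+k≡m  = begin
  binomMinor (suc i) m c (suc k)
    ≡⟨ binomMinor-pascal i m c k ⟩
  binomMinor (suc i) m (suc c) k +ℤ binomMinor i m c (suc k)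
    ≡⟨ cong₂ _+ℤ_ (binomMinor≡binomial m (suc i) (suc c) k (trans (sym (ℕP.+-suc c k)) c+k≡m))
                  (binomMinor≡binomial m i c (suc k) c+k≡m) ⟩
  + ((i + k) C k) +ℤ + ((i + suc k ∸ 1) C suc k)
    ≡⟨ pascal i k ⟩
  + ((i + suc k) C suc k) ∎

lemma5p1 : (d i r : ℕ) → 2 ≤ d → 1 ≤ i → 1 ≤ r → r ≤ d →
    bMinor (range i (i + d ∸ 2)) (remove (r ∸ 1) (range 0 (d ∸ 1)))
      ≡ + b (i + d ∸ r ∸ 1) (d ∸ r)
lemma5p1 (suc (suc m)) i (suc c) 2≤d _ _ r≤d = begin
  bMinor (range i (i + suc (suc m) ∸ 2)) (remove c (range 0 (suc m)))
    ≡⟨ cong₂ bMinor rows columns ⟩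
  bMinor (interval i (suc m)) (punctured c k)
    ≡⟨ bMinor-Δ (interval i (suc m)) (punctured c k) lengths ⟩
  binomMinor i (suc m) c k
    ≡⟨ binomMinor≡binomial (suc m) i c k c+k≡1+m ⟩
  + ((i + k ∸ 1) C k)
    ≡⟨ cong (λ t → + ((t ∸ 1) C k)) (sym (ℕP.+-∸-assoc i r≤d)) ⟩
  + b (i + suc (suc m) ∸ suc c ∸ 1) (suc (suc m) ∸ suc c) ∎
  where
  k = suc m ∸ c
  c+k≡1+m : c + k ≡ suc m
  c+k≡1+m = ℕP.m+[n∸m]≡n (ℕP.≤-pred r≤d)
  rows : range i (i + suc (suc m) ∸ 2) ≡ interval i (suc m)
  rows = range-interval (suc m) (trans (ℕP.+-suc i m) (cong suc (sym (ℕP.+-∸-assoc i 2≤d))))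
  columns : remove c (range 0 (suc m)) ≡ punctured c k
  columns = trans (cong (remove c) (range-interval (suc (c + k)) (cong suc c+k≡1+m)))
                  (remove-interval c k)
  lengths : length (punctured c k) ≡ length (interval i (suc m))
  lengths = trans (length-punctured c k) (trans c+k≡1+m (sym (length-interval i (suc m))))
lemma5p1 zero          _ _    ()       _ _  _
lemma5p1 (suc zero)    _ _    (s≤s ()) _ _  _
lemma5p1 (suc (suc m)) _ zero _        _ () _
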